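{- Let $k$ be an odd positive integer, let $m=(k-1)/2$, and let $n$ be an integer with $\gcd(n,k)=1$. For any integer $a$ define \[ F_k(a)=\sum_{i=1}^{m}\left\lfloor \frac{ai+m}{k}\right\rfloor. \] Let $N_k(n)$ be the number of pairs of positive integers $(b_1,b_2)$ such that $b_1\le m$, $b_2\le m$, $b_1+b_2\ge m+1$, and $b_2\equiv n b_1\pmod{k}$. Then \[ N_k(n)=F_k(n+1)-F_k(n). \] -}

module Defs where

open import Data.Nat as ℕ using (ℕ; suc)
open import Data.Integer using (ℤ; +_; _+_; _-_; _*_; _/ℕ_; _≤_; ∣_∣)
open import Data.Integer.Divisibility using (_∣_)
open import Data.List using (List; map; foldr; length; filter; upTo; concatMap)
open import Data.Product using (_×_; _,_; proj₁; proj₂)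
open import Relation.Unary using (Decidable)
open import Relation.Nullary.Decidable using (_×-dec_)
import Data.Integer.Properties as ℤP
import Data.Nat.Divisibility as ℕD

range1 : ℕ → List ℕ
range1 m = map suc (upTo m)

F : ℕ → ℤ → ℤ
F m a = foldr _+_ (+ 0) (map (λ i → (a * + i + + m) /ℕ (suc (2 ℕ.* m))) (range1 m))

Good : ℕ → ℤ → ℕ × ℕ → Set
Good m n (b₁ , b₂) =
  (+ suc m ≤ + b₁ + + b₂) × (+ suc (2 ℕ.* m) ∣ (+ b₂ - n * + b₁))

good? : ∀ m n → Decidable (Good m n)
good? m n (b₁ , b₂) =
  (+ suc m ℤP.≤? + b₁ + + b₂) ×-dec (suc (2 ℕ.* m) ℕD.∣? ∣ + b₂ - n * + b₁ ∣)

N : ℕ → ℤ → ℕ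
N m n = length (filter (good? m n)
  (concatMap (λ b₁ → map (λ b₂ → (b₁ , b₂)) (range1 m)) (range1 m)))

-- Split the pairs by their first coordinate b₁ = i. Modulo k the only candidate
-- for b₂ is s = n i mod k, so row i contributes 1 exactly when s ≤ m < i + s.
-- Writing n i = s + q k, both floors ⌊(n i + i + m)/k⌋ and ⌊(n i + m)/k⌋ shift by q,
-- and since 0 ≤ s < k and 1 ≤ i ≤ m the remaining ⌊(s + i + m)/k⌋ - ⌊(s + m)/k⌋
-- is that same indicator. Summing over the rows gives F_k(n+1) - F_k(n).
module Submission where

open import Defs
open import Data.Nat using (ℕ; suc; zero)
open import Data.Integer using (ℤ; +_; _+_; _-_; 1ℤ)
open import Data.Integer.GCD using (gcd)
open import Relation.Binary.PropositionalEquality using (_≡_)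

import Data.Nat as ℕ
import Data.Nat.Properties as ℕP
import Data.Nat.DivMod as ℕDM
open import Data.Nat.ListAction using (sum)
import Data.Integer as ℤ
open import Data.Integer using (_*_; _/ℕ_; _%ℕ_; -_; _≤_; _<_)
open import Data.Integer.Divisibility using (_∣_)
import Data.Integer.Divisibility.Signed as ℤS
import Data.Integer.DivMod as ℤDM
import Data.Integer.Properties as ℤP
open import Data.Integer.Tactic.RingSolver using (solve-∀)
open import Algebra.Properties.AbelianGroup ℤP.+-0-abelianGroup using (∙-cancelʳ)
open import Data.List using (List; []; _∷_; [_]; _++_; map; foldr; length; filter; upTo; concatMap)
import Data.List.Properties as LP
import Data.List.Relation.Unary.All as All
open import Data.List.Relation.Unary.Any using (here; there)
open import Data.List.Membership.Propositional using (_∈_)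
open import Data.List.Membership.Propositional.Properties using (∈-map⁻; ∈-upTo⁻)
open import Data.Product using (_×_; _,_; proj₁)
open import Relation.Unary using (Decidable)
open import Relation.Nullary using (¬_; yes; no)
open import Relation.Binary.PropositionalEquality
  using (refl; sym; trans; cong; cong₂; subst; module ≡-Reasoning)
open import Function using (_∘_)

open ≡-Reasoning

/ℕ-unique : ∀ k .{{_ : ℕ.NonZero k}} {x q} →
  q * + k ≤ x → x < ℤ.suc q * + k → x /ℕ k ≡ q
/ℕ-unique k {x} {q} q*k≤x x<[q+1]*k =
  ℤP.≤-antisym (bounded x<[q+1]*k (ℤDM.[n/ℕd]*d≤n x k))
               (bounded (ℤDM.n<s[n/ℕd]*d x k) q*k≤x)
  where
  bounded : ∀ {p r} → x < ℤ.suc r * + k → p * + k ≤ x → p ≤ r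
  bounded x<[r+1]*k p*k≤x = ℤP.≮⇒≥ λ r<p → ℤP.<-irrefl refl
    (ℤP.<-≤-trans x<[r+1]*k
      (ℤP.≤-trans (ℤP.*-monoʳ-≤-nonNeg (+ k) (ℤP.i<j⇒suc[i]≤j r<p)) p*k≤x))

[r+q*k]/ℕk≡q : ∀ k .{{_ : ℕ.NonZero k}} {r} q → r ℕ.< k → (+ r + q * + k) /ℕ k ≡ q
[r+q*k]/ℕk≡q k {r} q r<k = /ℕ-unique k (ℤP.i≤j+i (q * + k) (+ r))
  (subst (+ r + q * + k <_) (sym (ℤP.suc-* q (+ k)))
         (ℤP.+-monoˡ-< (q * + k) (ℤ.+<+ r<k)))

[r+q*k]%ℕk≡r : ∀ k .{{_ : ℕ.NonZero k}} {r} q → r ℕ.< k → (+ r + q * + k) %ℕ k ≡ r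
[r+q*k]%ℕk≡r k {r} q r<k = ℤP.+-injective (∙-cancelʳ (q * + k) _ _ (begin
  + (x %ℕ k) + q * + k      ≡⟨ cong (λ p → + (x %ℕ k) + p * + k) ([r+q*k]/ℕk≡q k q r<k) ⟨
  + (x %ℕ k) + x /ℕ k * + k ≡⟨ ℤDM.a≡a%ℕn+[a/ℕn]*n x k ⟨
  x                         ∎))
  where
  x : ℤ
  x = + r + q * + k

[r+q*k]/ℕk≡r/k+q : ∀ k .{{_ : ℕ.NonZero k}} r q →
  (+ r + q * + k) /ℕ k ≡ + (r ℕ./ k) + q
[r+q*k]/ℕk≡r/k+q k r q = begin
  (+ r + q * + k) /ℕ k
    ≡⟨ cong (λ z → (z + q * + k) /ℕ k) pos-r ⟩
  (+ (r ℕ.% k) + + (r ℕ./ k) * + k + q * + k) /ℕ k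
    ≡⟨ cong (_/ℕ k) (regroup (+ (r ℕ.% k)) (+ (r ℕ./ k)) q (+ k)) ⟩
  (+ (r ℕ.% k) + (+ (r ℕ./ k) + q) * + k) /ℕ k
    ≡⟨ [r+q*k]/ℕk≡q k (+ (r ℕ./ k) + q) (ℕDM.m%n<n r k) ⟩
  + (r ℕ./ k) + q ∎
  where
  pos-r : + r ≡ + (r ℕ.% k) + + (r ℕ./ k) * + k
  pos-r = trans (cong +_ (ℕDM.m≡m%n+[m/n]*n r k))
    (trans (ℤP.pos-+ (r ℕ.% k) _) (cong (λ z → + (r ℕ.% k) + z) (ℤP.pos-* (r ℕ./ k) k)))

  regroup : ∀ a b q k → a + b * k + q * k ≡ a + (b + q) * k
  regroup = solve-∀

[x+j]/ℕk≡[x%ℕk+j]/k+x/ℕk : ∀ k .{{_ : ℕ.NonZero k}} x j →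
  (x + + j) /ℕ k ≡ + ((x %ℕ k ℕ.+ j) ℕ./ k) + x /ℕ k
[x+j]/ℕk≡[x%ℕk+j]/k+x/ℕk k x j = begin
  (x + + j) /ℕ k
    ≡⟨ cong (λ z → (z + + j) /ℕ k) (ℤDM.a≡a%ℕn+[a/ℕn]*n x k) ⟩
  (+ (x %ℕ k) + x /ℕ k * + k + + j) /ℕ k
    ≡⟨ cong (_/ℕ k) (swap (+ (x %ℕ k)) (x /ℕ k * + k) (+ j)) ⟩
  (+ (x %ℕ k ℕ.+ j) + x /ℕ k * + k) /ℕ k
    ≡⟨ [r+q*k]/ℕk≡r/k+q k (x %ℕ k ℕ.+ j) (x /ℕ k) ⟩
  + ((x %ℕ k ℕ.+ j) ℕ./ k) + x /ℕ k ∎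
  where
  swap : ∀ a b c → a + b + c ≡ a + c + b
  swap = solve-∀

k∣b-x⇒b≡x%ℕk : ∀ k .{{_ : ℕ.NonZero k}} {b} x → b ℕ.< k → + k ∣ (+ b - x) → b ≡ x %ℕ k
k∣b-x⇒b≡x%ℕk k {b} x b<k k∣b-x with ℤS.∣ᵤ⇒∣ {i = + b - x} k∣b-x
... | ℤS.divides c b-x≡c*k = sym (begin
  x %ℕ k                  ≡⟨ cong (_%ℕ k) x≡b-c*k ⟩
  (+ b + - c * + k) %ℕ k  ≡⟨ [r+q*k]%ℕk≡r k (- c) b<k ⟩
  b                       ∎)
  where
  double-difference : ∀ a x → x ≡ a - (a - x)
  double-difference = solve-∀

  x≡b-c*k : x ≡ + b + - c * + k
  x≡b-c*k = begin
    x                 ≡⟨ double-difference (+ b) x ⟩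
    + b - (+ b - x)   ≡⟨ cong (λ z → + b - z) b-x≡c*k ⟩
    + b - c * + k     ≡⟨ cong (λ z → + b + z) (ℤP.neg-distribˡ-* c (+ k)) ⟩
    + b + - c * + k   ∎

k∣x%ℕk-x : ∀ k .{{_ : ℕ.NonZero k}} x → + k ∣ (+ (x %ℕ k) - x)
k∣x%ℕk-x k x = ℤS.∣⇒∣ᵤ (ℤS.divides (- (x /ℕ k)) (begin
  + (x %ℕ k) - x                         ≡⟨ cong (λ z → + (x %ℕ k) - z) (ℤDM.a≡a%ℕn+[a/ℕn]*n x k) ⟩
  + (x %ℕ k) - (+ (x %ℕ k) + x /ℕ k * + k) ≡⟨ difference (+ (x %ℕ k)) (x /ℕ k) (+ k) ⟩
  - (x /ℕ k) * + k                       ∎))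
  where
  difference : ∀ r q k → r - (r + q * k) ≡ - q * k
  difference = solve-∀

module _ {A B : Set} {P : A → Set} (P? : Decidable P) where

  length-filter-map : ∀ (f : B → A) xs →
    length (filter P? (map f xs)) ≡ length (filter (P? ∘ f) xs)
  length-filter-map f []       = refl
  length-filter-map f (x ∷ xs) with P? (f x)
  ... | yes _ = cong suc (length-filter-map f xs)
  ... | no  _ = length-filter-map f xs

  length-filter-concatMap : ∀ (h : B → List A) xs →
    length (filter P? (concatMap h xs)) ≡ sum (map (length ∘ filter P? ∘ h) xs)
  length-filter-concatMap h []       = refl
  length-filter-concatMap h (x ∷ xs) = begin
    length (filter P? (h x ++ concatMap h xs))
      ≡⟨ cong length (LP.filter-++ P? (h x) (concatMap h xs)) ⟩
    length (filter P? (h x) ++ filter P? (concatMap h xs))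
      ≡⟨ LP.length-++ (filter P? (h x)) ⟩
    length (filter P? (h x)) ℕ.+ length (filter P? (concatMap h xs))
      ≡⟨ cong (length (filter P? (h x)) ℕ.+_) (length-filter-concatMap h xs) ⟩
    sum (map (length ∘ filter P? ∘ h) (x ∷ xs)) ∎

sumℤ : List ℤ → ℤ
sumℤ = foldr _+_ (+ 0)

pos-sum-map-difference : ∀ xs (c : ℕ → ℕ) (f g : ℕ → ℤ) →
  (∀ {x} → x ∈ xs → + c x ≡ f x - g x) →
  + sum (map c xs) ≡ sumℤ (map f xs) - sumℤ (map g xs)
pos-sum-map-difference []       c f g c≡f-g = refl
pos-sum-map-difference (x ∷ xs) c f g c≡f-g = begin
  + (c x ℕ.+ sum (map c xs))
    ≡⟨ ℤP.pos-+ (c x) _ ⟩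
  + c x + + sum (map c xs)
    ≡⟨ cong₂ _+_ (c≡f-g (here refl)) (pos-sum-map-difference xs c f g (c≡f-g ∘ there)) ⟩
  (f x - g x) + (sumℤ (map f xs) - sumℤ (map g xs))
    ≡⟨ interchange (f x) (g x) _ _ ⟩
  sumℤ (map f (x ∷ xs)) - sumℤ (map g (x ∷ xs)) ∎
  where
  interchange : ∀ a b c d → (a - b) + (c - d) ≡ (a + c) - (b + d)
  interchange = solve-∀

∈-range1⁻ : ∀ {L b} → b ∈ range1 L → b ℕ.≤ L
∈-range1⁻ b∈ with ∈-map⁻ suc b∈
... | _ , a∈ , refl = ∈-upTo⁻ a∈

range1-suc : ∀ L → range1 (suc L) ≡ range1 L ++ [ suc L ]
range1-suc L = trans (cong (map suc) (sym (LP.upTo-∷ʳ L))) (LP.map-++ suc (upTo L) [ L ])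

module _ {P : ℕ → Set} (P? : Decidable P) where

  length-filter-range1-suc : ∀ L → length (filter P? (range1 (suc L)))
    ≡ length (filter P? (range1 L)) ℕ.+ length (filter P? [ suc L ])
  length-filter-range1-suc L = begin
    length (filter P? (range1 (suc L)))
      ≡⟨ cong (length ∘ filter P?) (range1-suc L) ⟩
    length (filter P? (range1 L ++ [ suc L ]))
      ≡⟨ cong length (LP.filter-++ P? (range1 L) [ suc L ]) ⟩
    length (filter P? (range1 L) ++ filter P? [ suc L ])
      ≡⟨ LP.length-++ (filter P? (range1 L)) ⟩
    length (filter P? (range1 L)) ℕ.+ length (filter P? [ suc L ]) ∎

  count-range1-none : ∀ L → (∀ b → b ℕ.≤ L → ¬ P b) → length (filter P? (range1 L)) ≡ 0
  count-range1-none L none =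
    cong length (LP.filter-none P? (All.tabulate λ b∈ → none _ (∈-range1⁻ b∈)))

  count-range1-single : ∀ L {c} → 1 ℕ.≤ c → c ℕ.≤ L → P c →
    (∀ b → b ℕ.≤ L → P b → b ≡ c) → length (filter P? (range1 L)) ≡ 1
  count-range1-single zero    (ℕ.s≤s _) ()
  count-range1-single (suc L) {c} 1≤c c≤L+1 Pc unique with c ℕP.≟ suc L
  ... | yes refl = begin
    length (filter P? (range1 (suc L)))
      ≡⟨ length-filter-range1-suc L ⟩
    length (filter P? (range1 L)) ℕ.+ length (filter P? [ suc L ])
      ≡⟨ cong₂ ℕ._+_ (count-range1-none L below-c) (cong length (LP.filter-accept P? Pc)) ⟩
    1 ∎
    where
    below-c : ∀ b → b ℕ.≤ L → ¬ P b
    below-c b b≤L Pb = ℕP.<-irrefl refl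
      (subst (ℕ._≤ L) (unique b (ℕP.m≤n⇒m≤1+n b≤L) Pb) b≤L)
  ... | no c≢L+1 = begin
    length (filter P? (range1 (suc L)))
      ≡⟨ length-filter-range1-suc L ⟩
    length (filter P? (range1 L)) ℕ.+ length (filter P? [ suc L ])
      ≡⟨ cong₂ ℕ._+_ (count-range1-single L 1≤c c≤L Pc unique-below)
                     (cong length (LP.filter-reject P? ¬P[L+1])) ⟩
    1 ∎
    where
    c≤L : c ℕ.≤ L
    c≤L = ℕ.s≤s⁻¹ (ℕP.≤∧≢⇒< c≤L+1 c≢L+1)

    unique-below : ∀ b → b ℕ.≤ L → P b → b ≡ c
    unique-below b b≤L = unique b (ℕP.m≤n⇒m≤1+n b≤L)

    ¬P[L+1] : ¬ P (suc L)
    ¬P[L+1] P[L+1] = c≢L+1 (sym (unique (suc L) ℕP.≤-refl P[L+1]))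

2*m≡m+m : ∀ m → 2 ℕ.* m ≡ m ℕ.+ m
2*m≡m+m m = cong (m ℕ.+_) (ℕP.+-identityʳ m)

t≤2m⇒t/[1+2m]≡0 : ∀ m {t} → t ℕ.≤ m ℕ.+ m → t ℕ./ suc (2 ℕ.* m) ≡ 0
t≤2m⇒t/[1+2m]≡0 m t≤2m rewrite 2*m≡m+m m = ℕDM.m<n⇒m/n≡0 (ℕ.s≤s t≤2m)

2m<t≤4m⇒t/[1+2m]≡1 : ∀ m {t} → m ℕ.+ m ℕ.< t → t ℕ.≤ (m ℕ.+ m) ℕ.+ (m ℕ.+ m) →
  t ℕ./ suc (2 ℕ.* m) ≡ 1
2m<t≤4m⇒t/[1+2m]≡1 m {t} 2m<t t≤4m rewrite 2*m≡m+m m =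
  trans (ℕDM.m/n≡1+[m∸n]/n 2m<t)
        (cong suc (ℕDM.m<n⇒m/n≡0 (ℕP.m<n+o⇒m∸n<o t (suc (m ℕ.+ m)) t<2k)))
  where
  t<2k : t ℕ.< suc (m ℕ.+ m) ℕ.+ suc (m ℕ.+ m)
  t<2k = ℕ.s≤s (ℕP.≤-trans t≤4m (ℕP.+-monoʳ-≤ (m ℕ.+ m) (ℕP.n≤1+n (m ℕ.+ m))))

module Row (m : ℕ) (n : ℤ) (i : ℕ) where

  k : ℕ
  k = suc (2 ℕ.* m)

  s : ℕ
  s = (n * + i) %ℕ k

  s≤m+m : s ℕ.≤ m ℕ.+ m
  s≤m+m = subst (s ℕ.≤_) (2*m≡m+m m) (ℕ.s≤s⁻¹ (ℤDM.n%ℕd<d (n * + i) k))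

  floor-difference : ((n + 1ℤ) * + i + + m) /ℕ k - (n * + i + + m) /ℕ k
                   ≡ + ((s ℕ.+ (i ℕ.+ m)) ℕ./ k) - + ((s ℕ.+ m) ℕ./ k)
  floor-difference = begin
    ((n + 1ℤ) * + i + + m) /ℕ k - (n * + i + + m) /ℕ k
      ≡⟨ cong (λ z → z /ℕ k - (n * + i + + m) /ℕ k) (expand n (+ i) (+ m)) ⟩
    (n * + i + + (i ℕ.+ m)) /ℕ k - (n * + i + + m) /ℕ k
      ≡⟨ cong₂ _-_ ([x+j]/ℕk≡[x%ℕk+j]/k+x/ℕk k (n * + i) (i ℕ.+ m))
                   ([x+j]/ℕk≡[x%ℕk+j]/k+x/ℕk k (n * + i) m) ⟩
    (+ ((s ℕ.+ (i ℕ.+ m)) ℕ./ k) + q) - (+ ((s ℕ.+ m) ℕ./ k) + q)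
      ≡⟨ cancel (+ ((s ℕ.+ (i ℕ.+ m)) ℕ./ k)) (+ ((s ℕ.+ m) ℕ./ k)) q ⟩
    + ((s ℕ.+ (i ℕ.+ m)) ℕ./ k) - + ((s ℕ.+ m) ℕ./ k) ∎
    where
    q : ℤ
    q = (n * + i) /ℕ k

    expand : ∀ n i m → (n + 1ℤ) * i + m ≡ n * i + (i + m)
    expand = solve-∀

    cancel : ∀ a b q → (a + q) - (b + q) ≡ a - b
    cancel = solve-∀

  good⇒≡s : ∀ {b} → b ℕ.≤ m → Good m n (i , b) → b ≡ s
  good⇒≡s {b} b≤m (_ , k∣b-ni) =
    k∣b-x⇒b≡x%ℕk k (n * + i) (ℕ.s≤s (ℕP.≤-trans b≤m (ℕP.m≤m+n m _))) k∣b-ni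

  good-s : suc m ℕ.≤ i ℕ.+ s → Good m n (i , s)
  good-s m<i+s = ℤ.+≤+ m<i+s , k∣x%ℕk-x k (n * + i)

  s+[i+m]≡[i+s]+m : s ℕ.+ (i ℕ.+ m) ≡ (i ℕ.+ s) ℕ.+ m
  s+[i+m]≡[i+s]+m = trans (sym (ℕP.+-assoc s i m)) (cong (ℕ._+ m) (ℕP.+-comm s i))

  count-by-residue : i ℕ.≤ m → + length (filter (good? m n ∘ (i ,_)) (range1 m))
            ≡ + ((s ℕ.+ (i ℕ.+ m)) ℕ./ k) - + ((s ℕ.+ m) ℕ./ k)
  count-by-residue i≤m with s ℕP.≤? m | suc m ℕP.≤? i ℕ.+ s
  ... | yes s≤m | yes m<i+s =
    trans (cong +_ (count-range1-single (good? m n ∘ (i ,_)) m 1≤s s≤m (good-s m<i+s)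
                                        (λ _ → good⇒≡s)))
          (sym (cong₂ (λ a b → + a - + b)
            (2m<t≤4m⇒t/[1+2m]≡1 m
              (subst (m ℕ.+ m ℕ.<_) (sym s+[i+m]≡[i+s]+m) (ℕP.+-monoˡ-≤ m m<i+s))
              (ℕP.≤-trans (ℕP.+-mono-≤ s≤m (ℕP.+-monoˡ-≤ m i≤m))
                          (ℕP.+-monoˡ-≤ (m ℕ.+ m) (ℕP.m≤m+n m m))))
            (t≤2m⇒t/[1+2m]≡0 m (ℕP.+-monoˡ-≤ m s≤m))))
    where
    1≤s : 1 ℕ.≤ s
    1≤s = ℕP.+-cancelˡ-≤ m 1 s (subst (ℕ._≤ m ℕ.+ s) (ℕP.+-comm 1 m)
            (ℕP.≤-trans m<i+s (ℕP.+-monoˡ-≤ s i≤m)))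
  ... | yes s≤m | no m≮i+s =
    trans (cong +_ (count-range1-none (good? m n ∘ (i ,_)) m no-witness))
          (sym (cong₂ (λ a b → + a - + b)
            (t≤2m⇒t/[1+2m]≡0 m
              (subst (ℕ._≤ m ℕ.+ m) (sym s+[i+m]≡[i+s]+m)
                     (ℕP.+-monoˡ-≤ m (ℕ.s≤s⁻¹ (ℕP.≰⇒> m≮i+s)))))
            (t≤2m⇒t/[1+2m]≡0 m (ℕP.+-monoˡ-≤ m s≤m))))
    where
    no-witness : ∀ b → b ℕ.≤ m → ¬ Good m n (i , b)
    no-witness b b≤m good = m≮i+s
      (subst (λ c → suc m ℕ.≤ i ℕ.+ c) (good⇒≡s b≤m good) (ℤP.drop‿+≤+ (proj₁ good)))
  ... | no s≰m | _ =
    trans (cong +_ (count-range1-none (good? m n ∘ (i ,_)) m no-witness))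
          (sym (cong₂ (λ a b → + a - + b)
            (2m<t≤4m⇒t/[1+2m]≡1 m
              (ℕP.≤-trans 2m<s+m (ℕP.+-monoʳ-≤ s (ℕP.m≤n+m m i)))
              (ℕP.+-mono-≤ s≤m+m (ℕP.+-monoˡ-≤ m i≤m)))
            (2m<t≤4m⇒t/[1+2m]≡1 m 2m<s+m (ℕP.+-mono-≤ s≤m+m (ℕP.m≤m+n m m)))))
    where
    2m<s+m : m ℕ.+ m ℕ.< s ℕ.+ m
    2m<s+m = ℕP.+-monoˡ-≤ m (ℕP.≰⇒> s≰m)

    no-witness : ∀ b → b ℕ.≤ m → ¬ Good m n (i , b)
    no-witness b b≤m good = s≰m (subst (ℕ._≤ m) (good⇒≡s b≤m good) b≤m)

  count : i ℕ.≤ m → + length (filter (good? m n) (map (i ,_) (range1 m)))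
        ≡ ((n + 1ℤ) * + i + + m) /ℕ k - (n * + i + + m) /ℕ k
  count i≤m = begin
    + length (filter (good? m n) (map (i ,_) (range1 m)))
      ≡⟨ cong +_ (length-filter-map (good? m n) (i ,_) (range1 m)) ⟩
    + length (filter (good? m n ∘ (i ,_)) (range1 m))
      ≡⟨ count-by-residue i≤m ⟩
    + ((s ℕ.+ (i ℕ.+ m)) ℕ./ k) - + ((s ℕ.+ m) ℕ./ k)
      ≡⟨ floor-difference ⟨
    ((n + 1ℤ) * + i + + m) /ℕ k - (n * + i + + m) /ℕ k ∎

-- The identity holds row by row for every n.
lemma2p6 : (m : ℕ) (n : ℤ) → gcd n (+ suc (2 Data.Nat.* m)) ≡ 1ℤ →
    + N m n ≡ F m (n + 1ℤ) - F m n
lemma2p6 m n _ = begin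
  + N m n
    ≡⟨ cong +_ (length-filter-concatMap (good? m n) rows (range1 m)) ⟩
  + sum (map (length ∘ filter (good? m n) ∘ rows) (range1 m))
    ≡⟨ pos-sum-map-difference (range1 m) _ _ _ (λ i∈ → Row.count m n _ (∈-range1⁻ i∈)) ⟩
  F m (n + 1ℤ) - F m n ∎
  where
  rows : ℕ → List (ℕ × ℕ)
  rows b₁ = map (b₁ ,_) (range1 m)
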